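{- Fix a positive integer $s$ and $\epsilon\in\{1,-1\}$, and let the positive integers $v$ and $m$ vary within fixed congruence classes modulo $s$ (always excluding $\epsilon=-1$, $vm^2\le4$). Then, for each $n\ge0$, the packet $E_n$ of the pattern continued fraction of $\xi=svm/2+\sqrt{s^2v(vm^2+4\epsilon)/4}$ has a length independent of $(v,m)$, and every term of $E_n$ is independent of $(v,m)$ except its initial term, which is linear (affine, with coefficients independent of $v,m$) in $m$ when $n$ is odd and in $vm$ when $n$ is even.
   Context: Let $\delta_\epsilon=0$ if $\epsilon=1$ and $\delta_\epsilon=1$ if $\epsilon=-1$. Let $v_n=v$ for even $n$ and $v_n=1$ for odd $n$; $a_0=0$, $a_1=1$, $a_{n+1}=v_nma_n+\epsilon a_{n-1}$. For $n\ge0$ let $s_n=\gcd(a_n,s)$, let $m_n$ be the unique integer with $0\le m_n<s/s_n$ and $m_n(a_n/s_n)\equiv-a_{n-1}\pmod{s/s_n}$ (so $m_0=0$), and $\hat\xi_n=(s_nv_nm-\epsilon m_n)/(s/s_n)$. Every rational has exactly two finite continued fraction expansions $[c_0,\dots,c_r]$ with $c_0\in\mathbb{Z}$, $c_1,\dots,c_r\ge1$, whose lengths differ by one. The packet $E_0$ is the expansion of $\hat\xi_0$ and the packet $E_n$ ($n\ge1$) is the expansion of $\hat\xi_n-\delta_\epsilon$, each chosen with an odd number of terms if $\epsilon=1$ and an even number if $\epsilon=-1$. The pattern continued fraction of $\xi$ is the infinite continued fraction whose terms are the concatenation $E_0,E_1,E_2,\dots$ (it converges to $\xi$). -}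

module Defs where

open import Data.Nat as ℕ using (ℕ; zero; suc; NonZero; _%_)
open import Data.Nat.Properties as ℕP using ()
open import Data.Nat.GCD using (gcd; gcd[m,n]≢0; gcd[m,n]∣n)
open import Data.Nat.Divisibility using (∣⇒≤)
open import Data.Nat.DivMod using (m≥n⇒m/n>0)
open import Data.Integer as ℤ using (ℤ; +_; ∣_∣)
open import Data.Integer.DivMod using (_/ℕ_)
open import Data.Integer.Divisibility as ℤD using ()
open import Data.Rational as ℚ using (ℚ; ↥_; ↧_; 0ℚ; 1ℚ)
open import Data.Sign as Sign using (Sign)
open import Data.List using (List; []; _∷_; length)
open import Data.List.Relation.Unary.All using (All)
open import Data.Product using (Σ; _×_; _,_; proj₁; proj₂)
open import Data.Sum using (inj₂)
open import Data.Empty using (⊥)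
open import Relation.Binary.PropositionalEquality using (_≡_)

-- ε ∈ {1,-1} is represented by a Sign (Sign.+ ↦ 1, Sign.- ↦ -1).

εℤ : Sign → ℤ
εℤ e = e ℤ.◃ 1

δ : Sign → ℚ
δ Sign.+ = 0ℚ
δ Sign.- = 1ℚ

vₙ : ℕ → ℕ → ℕ
vₙ v zero = v
vₙ v (suc zero) = 1
vₙ v (suc (suc n)) = vₙ v n

aₙ : Sign → (v m : ℕ) → ℕ → ℤ
aₙ e v m zero = + 0
aₙ e v m (suc zero) = + 1
aₙ e v m (suc (suc n)) =
  (+ (vₙ v (suc n) ℕ.* m)) ℤ.* aₙ e v m (suc n) ℤ.+ εℤ e ℤ.* aₙ e v m n

sₙ : (s : ℕ) → Sign → (v m : ℕ) → ℕ → ℕ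
sₙ s e v m n = gcd ∣ aₙ e v m n ∣ s

sₙ-nonZero : (s : ℕ) .{{_ : NonZero s}} (e : Sign) (v m n : ℕ) → NonZero (sₙ s e v m n)
sₙ-nonZero s e v m n =
  ℕ.≢-nonZero (gcd[m,n]≢0 ∣ aₙ e v m n ∣ s (inj₂ (ℕ.≢-nonZero⁻¹ s)))

dₙ : (s : ℕ) .{{_ : NonZero s}} → Sign → (v m : ℕ) → ℕ → ℕ
dₙ s e v m n = (s ℕ./ sₙ s e v m n) {{sₙ-nonZero s e v m n}}

dₙ-nonZero : (s : ℕ) .{{_ : NonZero s}} (e : Sign) (v m n : ℕ) → NonZero (dₙ s e v m n)
dₙ-nonZero s e v m n = ℕ.>-nonZero
  (m≥n⇒m/n>0 {{sₙ-nonZero s e v m n}} (∣⇒≤ (gcd[m,n]∣n ∣ aₙ e v m n ∣ s)))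

aₙ/sₙ : (s : ℕ) .{{_ : NonZero s}} → Sign → (v m : ℕ) → ℕ → ℤ
aₙ/sₙ s e v m n = (aₙ e v m n /ℕ sₙ s e v m n) {{sₙ-nonZero s e v m n}}

-- k is m_n: 0 ≤ k < s/s_n and k (a_n/s_n) ≡ -a_{n-1} (mod s/s_n).
-- (For n = 0 the interval forces k = 0, matching m_0 = 0.)
IsMₙ : (s : ℕ) .{{_ : NonZero s}} → Sign → (v m : ℕ) → ℕ → ℤ → Set
IsMₙ s e v m n k =
  (+ 0 ℤ.≤ k) × (k ℤ.< + dₙ s e v m n)
  × (+ dₙ s e v m n) ℤD.∣ (k ℤ.* aₙ/sₙ s e v m n ℤ.+ aₙ e v m (n ℕ.∸ 1))

ξ̂ : (s : ℕ) .{{_ : NonZero s}} → Sign → (v m : ℕ) → ℕ → ℤ → ℚ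
ξ̂ s e v m n k =
  (((+ (sₙ s e v m n ℕ.* vₙ v n ℕ.* m)) ℤ.- εℤ e ℤ.* k) ℚ./ dₙ s e v m n)
    {{dₙ-nonZero s e v m n}}

-- the rational whose expansion is the packet: ξ̂_0 for n = 0, ξ̂_n - δ_ε for n ≥ 1
target : (s : ℕ) .{{_ : NonZero s}} → Sign → (v m : ℕ) → ℕ → ℤ → ℚ
target s e v m zero k = ξ̂ s e v m zero k
target s e v m (suc n) k = ξ̂ s e v m (suc n) k ℚ.- δ e

-- Finite continued fractions [c_0, ..., c_r] as lists of integers.
-- cfND returns (numerator, denominator) by the standard recursion
-- [c] = c/1, [c, rest] = c + 1/[rest]  (with [] read as 1/0).

cfND : List ℤ → ℤ × ℤ
cfND [] = + 1 , + 0
cfND (c ∷ cs) = c ℤ.* proj₁ (cfND cs) ℤ.+ proj₂ (cfND cs) , proj₁ (cfND cs)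

IsCFExpansion : ℚ → List ℤ → Set
IsCFExpansion q [] = ⊥
IsCFExpansion q (c₀ ∷ cs) =
  All (λ c → + 1 ℤ.≤ c) cs
  × ((↥ q) ℤ.* proj₂ (cfND (c₀ ∷ cs)) ≡ proj₁ (cfND (c₀ ∷ cs)) ℤ.* (↧ q))

GoodParity : Sign → ℕ → Set
GoodParity Sign.+ len = len % 2 ≡ 1
GoodParity Sign.- len = len % 2 ≡ 0

IsPacket : (s : ℕ) .{{_ : NonZero s}} → Sign → (v m : ℕ) → ℕ → List ℤ → Set
IsPacket s e v m n E =
  Σ ℤ λ k → IsMₙ s e v m n k × IsCFExpansion (target s e v m n k) E
            × GoodParity e (length E)

linVar : ℕ → (v m : ℕ) → ℕ
linVar zero v m = v ℕ.* m
linVar (suc zero) v m = m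
linVar (suc (suc n)) v m = linVar n v m

-- The packet rational ξ̂_n − δ_ε equals N / d with d = s / s_n and N = s_n L − ε m_n − δ_ε d,
-- where L = v_n m is m or v m. Moving (v, m) inside its residue classes modulo s fixes a_n and
-- a_(n−1) modulo s, hence s_n, d, a_n / s_n modulo d and therefore m_n (a_n / s_n is a unit
-- modulo d), while L moves by a multiple j s = j d s_n of s; so the rational moves by the
-- integer s_n² j. A rational has exactly one finite expansion with positive partial quotients
-- of each length parity, and adding an integer to the rational only adds it to the first term.
-- So the packet keeps its tail, and its first term is c + s_n² j = α + (s_n / d) L.
module Submission where

open import Defs
open import Data.Nat as ℕ using (ℕ; zero; suc; NonZero; _%_; _/_; z≤n; s≤s)
import Data.Nat.Properties as ℕP
import Data.Nat.DivMod as ℕDM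
import Data.Nat.Divisibility as ℕD
import Data.Nat.Coprimality as ℕC
open import Data.Nat.GCD using (gcd; gcd[m,n]∣m; gcd[m,n]∣n; gcd-greatest)
open import Data.Nat.Induction using (<-wellFounded)
open import Induction.WellFounded using (Acc; acc)
open import Data.Integer as ℤ using (ℤ; +_; -[1+_]; _+_; _*_; _-_; -_; ∣_∣; +≤+; +<+; _/ℕ_; _%ℕ_)
import Data.Integer.Properties as ℤP
open import Data.Integer.DivMod using (a≡a%ℕn+[a/ℕn]*n; n%ℕd<d)
import Data.Integer.Divisibility as ℤD
open import Data.Integer.Divisibility.Signed as ℤS using (divides)
open import Data.Integer.Coprimality using (Coprime; coprime-divisor)
open import Data.Integer.Tactic.RingSolver using (solve-∀)
open import Algebra.Properties.CommutativeSemigroup ℤP.*-commutativeSemigroup using (xy∙z≈xz∙y)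
open import Data.Rational as ℚ using (ℚ; mkℚ; toℚᵘ; 0ℚ)
import Data.Rational.Properties as ℚP
open import Data.Rational.Solver using (module +-*-Solver)
open import Data.Rational.Unnormalised as ℚᵘ using (mkℚᵘ; *≡*) renaming (_≃_ to _≃ᵘ_)
import Data.Rational.Unnormalised.Properties as ℚᵘP
open import Data.Parity.Base using (Parity; 0ℙ; 1ℙ; _⁻¹)
open import Data.Parity.Properties
  using (suc-homo-⁻¹; ⁻¹-selfInverse; ⁻¹-injective; ⁻¹-involutive; p≢p⁻¹)
open import Data.Sign as Sign using (Sign)
open import Data.Fin using (toℕ; fromℕ<)
open import Data.Fin.Properties using (any?; toℕ<n; toℕ-fromℕ<)
open import Data.List using (List; []; _∷_; length)
open import Data.List.Properties using (∷-injective)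
open import Data.List.Relation.Unary.All using (All; []; _∷_)
open import Data.Product using (Σ; _×_; _,_; proj₁; proj₂)
open import Data.Empty using (⊥-elim)
open import Relation.Nullary using (Dec; yes; no)
open import Relation.Nullary.Decidable using (map′)
open import Relation.Binary.PropositionalEquality

parity-suc : ∀ n → ℕ.parity (suc n) ≡ ℕ.parity n ⁻¹
parity-suc n = sym (⁻¹-selfInverse (suc-homo-⁻¹ n))

parity-suc-injective : ∀ m n → ℕ.parity (suc m) ≡ ℕ.parity (suc n) → ℕ.parity m ≡ ℕ.parity n
parity-suc-injective m n eq = ⁻¹-injective (trans (sym (parity-suc m)) (trans eq (parity-suc n)))

-- Finite continued fractions with positive tails

AllPositive : List ℤ → Set
AllPositive = All (λ c → + 1 ℤ.≤ c)

mutual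
  num : List ℤ → ℕ
  num [] = 1
  num (c ∷ cs) = ∣ c ∣ ℕ.* num cs ℕ.+ den cs

  den : List ℤ → ℕ
  den [] = 0
  den (c ∷ cs) = num cs

cfND-positive : ∀ {cs} → AllPositive cs → cfND cs ≡ (+ num cs , + den cs)
cfND-positive [] = refl
cfND-positive {+ suc k ∷ cs} (+≤+ (s≤s _) ∷ ps) rewrite cfND-positive ps =
  cong (_, + num cs) (sym (trans (ℤP.pos-+ (suc k ℕ.* num cs) (den cs))
                               (cong (_+ + den cs) (ℤP.pos-* (suc k) (num cs)))))

num-positive : ∀ {cs} → AllPositive cs → 1 ℕ.≤ num cs
den≤num : ∀ {cs} → AllPositive cs → den cs ℕ.≤ num cs

num-positive [] = s≤s z≤n
num-positive ps@(_ ∷ ps') = ℕP.≤-trans (num-positive ps') (den≤num ps)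

den≤num [] = z≤n
den≤num {+ suc k ∷ cs} (+≤+ (s≤s _) ∷ _) =
  ℕP.≤-trans (ℕP.m≤m+n (num cs) (k ℕ.* num cs)) (ℕP.m≤m+n _ (den cs))

cfND-numerator≢0 : ∀ {cs} → AllPositive cs → proj₁ (cfND cs) ≢ + 0
cfND-numerator≢0 ps eq =
  ℕP.<⇒≢ (num-positive ps) (sym (ℤP.+-injective (trans (sym (cong proj₁ (cfND-positive ps))) eq)))

den≡num⇒length≡1 : ∀ {cs} → AllPositive cs → den cs ≡ num cs → length cs ≡ 1
den≡num⇒length≡1 [] ()
den≡num⇒length≡1 (_ ∷ []) _ = refl
den≡num⇒length≡1 {+ suc k ∷ cs} (+≤+ (s≤s _) ∷ (_ ∷ ps)) eq =
  ⊥-elim (ℕP.<⇒≢ (num-positive ps) (sym den≡0))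
  where
  den≡0 : den cs ≡ 0
  den≡0 = ℕP.m+n≡0⇒n≡0 (k ℕ.* num cs) (sym (ℕP.+-cancelˡ-≡ (num cs) 0 _
            (trans (ℕP.+-identityʳ (num cs)) (trans eq (ℕP.+-assoc (num cs) _ _)))))

-- den cs / num cs lies in [0, 1]; it is 0 only for [] and 1 only for [1], so two
-- such fractions of tails with equal length parity never differ by a positive integer.
no-integer-gap : ∀ {cs cs'} → AllPositive cs → AllPositive cs' →
  ℕ.parity (length cs) ≡ ℕ.parity (length cs') →
  ∀ w → suc w ℕ.* (num cs ℕ.* num cs') ℕ.+ den cs ℕ.* num cs' ≢ den cs' ℕ.* num cs
no-integer-gap {[]} {cs'} [] ps' par w eq =
  p≢p⁻¹ 0ℙ (trans par (cong ℕ.parity (den≡num⇒length≡1 ps' den≡num)))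
  where
  open ℕP.≤-Reasoning
  den≡num : den cs' ≡ num cs'
  den≡num = ℕP.≤-antisym (den≤num ps') (begin
    num cs'                           ≤⟨ ℕP.m≤n*m (num cs') (suc w) ⟩
    suc w ℕ.* num cs'                 ≡⟨ cong (suc w ℕ.*_) (sym (ℕP.*-identityˡ (num cs'))) ⟩
    suc w ℕ.* (1 ℕ.* num cs')         ≤⟨ ℕP.m≤m+n _ 0 ⟩
    suc w ℕ.* (1 ℕ.* num cs') ℕ.+ 0   ≡⟨ eq ⟩
    den cs' ℕ.* 1                     ≡⟨ ℕP.*-identityʳ (den cs') ⟩
    den cs'                           ∎)
no-integer-gap {cs} {cs'} ps@(_ ∷ ps₀) ps' par w eq = ℕP.<⇒≢ gap (sym eq)
  where
  open ℕP.≤-Reasoning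
  gap : den cs' ℕ.* num cs ℕ.< suc w ℕ.* (num cs ℕ.* num cs') ℕ.+ den cs ℕ.* num cs'
  gap = begin-strict
    den cs' ℕ.* num cs              ≤⟨ ℕP.*-monoˡ-≤ (num cs) (den≤num ps') ⟩
    num cs' ℕ.* num cs              ≡⟨ ℕP.*-comm (num cs') (num cs) ⟩
    num cs ℕ.* num cs'              ≤⟨ ℕP.m≤n*m _ (suc w) ⟩
    suc w ℕ.* (num cs ℕ.* num cs')  <⟨ ℕP.m<m+n _ (ℕP.*-mono-≤ (num-positive ps₀) (num-positive ps')) ⟩
    suc w ℕ.* (num cs ℕ.* num cs') ℕ.+ den cs ℕ.* num cs' ∎

no-integer-gapℤ : ∀ {cs cs'} → AllPositive cs → AllPositive cs' →
  ℕ.parity (length cs) ≡ ℕ.parity (length cs') → ∀ w →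
  + suc w * (+ num cs * + num cs') ≢ + den cs' * + num cs - + den cs * + num cs'
no-integer-gapℤ {cs} {cs'} ps ps' par w eq = no-integer-gap ps ps' par w (ℤP.+-injective (begin
  + (suc w ℕ.* (P ℕ.* P') ℕ.+ Q ℕ.* P')       ≡⟨ ℤP.pos-+ (suc w ℕ.* (P ℕ.* P')) (Q ℕ.* P') ⟩
  + (suc w ℕ.* (P ℕ.* P')) + + (Q ℕ.* P')     ≡⟨ cong₂ _+_ gap (ℤP.pos-* Q P') ⟩
  (+ Q' * + P - + Q * + P') + + Q * + P'       ≡⟨ minus-plus (+ Q' * + P) (+ Q * + P') ⟩
  + Q' * + P                                   ≡⟨ ℤP.pos-* Q' P ⟨
  + (Q' ℕ.* P)                                 ∎))
  where
  open ≡-Reasoning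
  P P' Q Q' : ℕ
  P = num cs
  P' = num cs'
  Q = den cs
  Q' = den cs'
  gap : + (suc w ℕ.* (P ℕ.* P')) ≡ + Q' * + P - + Q * + P'
  gap = trans (ℤP.pos-* (suc w) (P ℕ.* P')) (trans (cong (+ suc w *_) (ℤP.pos-* P P')) eq)
  minus-plus : ∀ x y → x - y + y ≡ x
  minus-plus = solve-∀

head-difference≡0 : ∀ {cs cs'} → AllPositive cs → AllPositive cs' →
  ℕ.parity (length cs) ≡ ℕ.parity (length cs') → ∀ w →
  w * (+ num cs * + num cs') ≡ + den cs' * + num cs - + den cs * + num cs' → w ≡ + 0
head-difference≡0 _ _ _ (+ zero) _ = refl
head-difference≡0 ps ps' par (+ suc w) eq = ⊥-elim (no-integer-gapℤ ps ps' par w eq)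
head-difference≡0 {cs} {cs'} ps ps' par -[1+ w ] eq =
  ⊥-elim (no-integer-gapℤ ps' ps (sym par) w (negate (+ suc w) (+ num cs) (+ num cs')
    (+ den cs' * + num cs) (+ den cs * + num cs') eq))
  where
  negate : ∀ x P P' y z → - x * (P * P') ≡ y - z → x * (P' * P) ≡ z - y
  negate x P P' y z eq = trans (double-negation x P P') (trans (cong -_ eq) (negate-minus y z))
    where
    double-negation : ∀ x P P' → x * (P' * P) ≡ - (- x * (P * P'))
    double-negation = solve-∀
    negate-minus : ∀ y z → - (y - z) ≡ z - y
    negate-minus = solve-∀

cross-difference : ∀ c c' P P' Q Q' → (c * P + Q) * P' ≡ (c' * P' + Q') * P →
  (c - c') * (P * P') ≡ Q' * P - Q * P'
cross-difference c c' P P' Q Q' eq = begin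
  (c - c') * (P * P')
    ≡⟨ expand c c' P P' Q Q' ⟩
  ((c * P + Q) * P' - (c' * P' + Q') * P) + (Q' * P - Q * P')
    ≡⟨ cong (λ x → (x - (c' * P' + Q') * P) + (Q' * P - Q * P')) eq ⟩
  ((c' * P' + Q') * P - (c' * P' + Q') * P) + (Q' * P - Q * P')
    ≡⟨ cancel ((c' * P' + Q') * P) (Q' * P - Q * P') ⟩
  Q' * P - Q * P' ∎
  where
  open ≡-Reasoning
  expand : ∀ c c' P P' Q Q' →
    (c - c') * (P * P') ≡ ((c * P + Q) * P' - (c' * P' + Q') * P) + (Q' * P - Q * P')
  expand = solve-∀
  cancel : ∀ x y → (x - x) + y ≡ y
  cancel = solve-∀

SameValue : List ℤ → List ℤ → Set
SameValue xs ys = proj₁ (cfND xs) * proj₂ (cfND ys) ≡ proj₁ (cfND ys) * proj₂ (cfND xs)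

heads-unique : ∀ {c c' cs cs'} → AllPositive cs → AllPositive cs' →
  ℕ.parity (length cs) ≡ ℕ.parity (length cs') → SameValue (c ∷ cs) (c' ∷ cs') → c ∷ cs ≡ c' ∷ cs'
tails-unique : ∀ {cs cs'} → AllPositive cs → AllPositive cs' →
  ℕ.parity (length cs) ≡ ℕ.parity (length cs') → SameValue cs cs' → cs ≡ cs'

heads-unique {c} {c'} {cs} {cs'} ps ps' par same =
  cong₂ _∷_ (ℤP.i-j≡0⇒i≡j c c' c-c'≡0) (tails-unique ps ps' par tails-same)
  where
  P P' Q Q' : ℤ
  P = + num cs
  P' = + num cs'
  Q = + den cs
  Q' = + den cs'
  difference : (c - c') * (P * P') ≡ Q' * P - Q * P'
  difference = cross-difference c c' P P' Q Q' (subst₂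
    (λ x y → (c * proj₁ x + proj₂ x) * proj₁ y ≡ (c' * proj₁ y + proj₂ y) * proj₁ x)
    (cfND-positive ps) (cfND-positive ps') same)
  c-c'≡0 : c - c' ≡ + 0
  c-c'≡0 = head-difference≡0 ps ps' par (c - c') difference
  Q'P≡QP' : Q' * P ≡ Q * P'
  Q'P≡QP' = ℤP.i-j≡0⇒i≡j _ _
    (trans (sym difference) (trans (cong (_* (P * P')) c-c'≡0) (ℤP.*-zeroˡ (P * P'))))
  tails-same : SameValue cs cs'
  tails-same = subst₂ (λ x y → proj₁ x * proj₂ y ≡ proj₁ y * proj₂ x)
    (sym (cfND-positive ps)) (sym (cfND-positive ps'))
    (trans (ℤP.*-comm P Q') (trans Q'P≡QP' (ℤP.*-comm Q P')))

tails-unique [] [] _ _ = refl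
tails-unique {cs' = cs'@(_ ∷ ds')} [] (_ ∷ ps') _ same = ⊥-elim (cfND-numerator≢0 ps'
  (trans (sym (ℤP.*-identityˡ (proj₁ (cfND ds')))) (trans same (ℤP.*-zeroʳ (proj₁ (cfND cs'))))))
tails-unique {cs = cs@(_ ∷ ds)} (_ ∷ ps) [] _ same = ⊥-elim (cfND-numerator≢0 ps
  (trans (sym (ℤP.*-identityˡ (proj₁ (cfND ds)))) (trans (sym same) (ℤP.*-zeroʳ (proj₁ (cfND cs))))))
tails-unique {_ ∷ ds} {_ ∷ ds'} (_ ∷ ps) (_ ∷ ps') par same =
  heads-unique ps ps' (parity-suc-injective (length ds) (length ds') par) same

data Represents (N : ℤ) (D : ℕ) (xs : List ℤ) : Set where
  cross : N * proj₂ (cfND xs) ≡ proj₁ (cfND xs) * + D → Represents N D xs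

represents-sameValue : ∀ {N D xs ys} .{{_ : NonZero D}} →
  Represents N D xs → Represents N D ys → SameValue xs ys
represents-sameValue {N} {D} {xs} {ys} (cross rx) (cross ry) = ℤP.*-cancelʳ-≡ _ _ (+ D) (begin
  (p * q') * + D  ≡⟨ xy∙z≈xz∙y p q' (+ D) ⟩
  (p * + D) * q'  ≡⟨ cong (_* q') rx ⟨
  (N * q) * q'    ≡⟨ xy∙z≈xz∙y N q q' ⟩
  (N * q') * q    ≡⟨ cong (_* q) ry ⟩
  (p' * + D) * q  ≡⟨ xy∙z≈xz∙y p' (+ D) q ⟩
  (p' * q) * + D  ∎)
  where
  open ≡-Reasoning
  p q p' q' : ℤ
  p = proj₁ (cfND xs)
  q = proj₂ (cfND xs)
  p' = proj₁ (cfND ys)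
  q' = proj₂ (cfND ys)

expansions-unique : ∀ {N D c c' cs cs'} .{{_ : NonZero D}} → AllPositive cs → AllPositive cs' →
  ℕ.parity (length cs) ≡ ℕ.parity (length cs') →
  Represents N D (c ∷ cs) → Represents N D (c' ∷ cs') → c ∷ cs ≡ c' ∷ cs'
expansions-unique ps ps' par r r' = heads-unique ps ps' par (represents-sameValue r r')

represents-shift : ∀ {N D c cs} t → Represents N D (c ∷ cs) → Represents (N + t * + D) D ((c + t) ∷ cs)
represents-shift {N} {D} {c} {cs} t (cross r) =
  cross (shift N (+ D) c t (proj₁ (cfND cs)) (proj₂ (cfND cs)) r)
  where
  shift : ∀ N D c t p q → N * p ≡ (c * p + q) * D → (N + t * D) * p ≡ ((c + t) * p + q) * D
  shift N D c t p q eq = begin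
    (N + t * D) * p              ≡⟨ distrib N t D p ⟩
    N * p + t * p * D            ≡⟨ cong (_+ t * p * D) eq ⟩
    (c * p + q) * D + t * p * D  ≡⟨ collect c t p q D ⟩
    ((c + t) * p + q) * D        ∎
    where
    open ≡-Reasoning
    distrib : ∀ N t D p → (N + t * D) * p ≡ N * p + t * p * D
    distrib = solve-∀
    collect : ∀ c t p q D → (c * p + q) * D + t * p * D ≡ ((c + t) * p + q) * D
    collect = solve-∀

represents-step : ∀ {n d ρ q cs} → Represents (+ d) ρ cs → n ≡ + ρ + q * + d → Represents n d (q ∷ cs)
represents-step {d = d} {ρ} {q} {cs} (cross r) refl =
  cross (step (+ d) (+ ρ) q (proj₁ (cfND cs)) (proj₂ (cfND cs)) r)
  where
  step : ∀ d ρ q p r → d * r ≡ p * ρ → (ρ + q * d) * p ≡ (q * p + r) * d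
  step d ρ q p r eq = begin
    (ρ + q * d) * p      ≡⟨ expand ρ q d p ⟩
    p * ρ + q * p * d    ≡⟨ cong (_+ q * p * d) eq ⟨
    d * r + q * p * d    ≡⟨ collect d r q p ⟩
    (q * p + r) * d      ∎
    where
    open ≡-Reasoning
    expand : ∀ ρ q d p → (ρ + q * d) * p ≡ p * ρ + q * p * d
    expand = solve-∀
    collect : ∀ d r q p → d * r + q * p * d ≡ (q * p + r) * d
    collect = solve-∀

record Expansion (N : ℤ) (D : ℕ) (p : Parity) : Set where
  constructor mkExpansion
  field
    head : ℤ
    tail : List ℤ
    tail-positive : AllPositive tail
    represents : Represents N D (head ∷ tail)
    tail-parity : ℕ.parity (length tail) ≡ p

-- [] has value 1/0 and [1] has value 1, so an exact quotient q ends either as [q] or as [q − 1, 1].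
exact-expansion : ∀ p {N d} q → N ≡ q * + d → Expansion N d p
exact-expansion 0ℙ {d = d} q eq = mkExpansion q [] []
  (represents-step (cross (ℤP.*-zeroʳ (+ d))) (trans eq (sym (ℤP.+-identityˡ (q * + d))))) refl
exact-expansion 1ℙ {d = d} q eq = mkExpansion (q - + 1) (+ 1 ∷ []) (+≤+ (s≤s z≤n) ∷ [])
  (represents-step (cross (ℤP.*-comm (+ d) (+ 1))) (trans eq (peel q (+ d)))) refl
  where
  peel : ∀ q d → q * d ≡ d + (q - + 1) * d
  peel = solve-∀

exact-tail : ∀ p {D r} q → 1 ℕ.< q → + D ≡ + q * + r →
  Σ (List ℤ) λ cs → AllPositive cs × Represents (+ D) r cs × ℕ.parity (length cs) ≡ p
exact-tail 1ℙ {r = r} (suc q) _ eq =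
  + suc q ∷ [] , +≤+ (s≤s z≤n) ∷ [] ,
  represents-step (cross (ℤP.*-zeroʳ (+ r))) (trans eq (sym (ℤP.+-identityˡ (+ suc q * + r)))) , refl
exact-tail 0ℙ (suc zero) (s≤s ()) _
exact-tail 0ℙ {r = r} (suc (suc q)) _ eq =
  + suc q ∷ + 1 ∷ [] , +≤+ (s≤s z≤n) ∷ +≤+ (s≤s z≤n) ∷ [] ,
  represents-step (cross (ℤP.*-comm (+ r) (+ 1))) (trans eq (peel (+ suc q) (+ r))) , refl
  where
  peel : ∀ q r → (+ 1 + q) * r ≡ r + q * r
  peel = solve-∀

tail-expansion : ∀ p {r} → Acc ℕ._<_ r → ∀ {D} .{{_ : NonZero r}} → r ℕ.< D →
  Σ (List ℤ) λ cs → AllPositive cs × Represents (+ D) r cs × ℕ.parity (length cs) ≡ p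
tail-expansion p {r} (acc rec) {D} r<D with D % r in remainder | a≡a%ℕn+[a/ℕn]*n (+ D) r
... | zero | division = exact-tail p (D / r) (ℕP.*-cancelʳ-< r 1 (D / r) 1*r<q*r) exact
  where
  exact : + D ≡ + (D / r) * + r
  exact = trans division (ℤP.+-identityˡ _)
  1*r<q*r : 1 ℕ.* r ℕ.< D / r ℕ.* r
  1*r<q*r = subst₂ ℕ._<_ (sym (ℕP.*-identityˡ r))
    (ℤP.+-injective (trans exact (sym (ℤP.pos-* (D / r) r)))) r<D
... | suc ρ | division with tail-expansion (p ⁻¹) (rec ρ<r) {r} ρ<r
  where
  ρ<r : suc ρ ℕ.< r
  ρ<r = subst (ℕ._< r) remainder (ℕDM.m%n<n D r)
...   | cs , ps , rep , par =
  + (D / r) ∷ cs , +≤+ (ℕDM.m≥n⇒m/n>0 (ℕP.<⇒≤ r<D)) ∷ ps , represents-step rep division ,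
  trans (parity-suc (length cs)) (trans (cong _⁻¹ par) (⁻¹-involutive p))

expansion : ∀ p N D .{{_ : NonZero D}} → Expansion N D p
expansion p N D with N %ℕ D in remainder | a≡a%ℕn+[a/ℕn]*n N D
... | zero | division = exact-expansion p (N /ℕ D) (trans division (ℤP.+-identityˡ _))
... | suc ρ | division
  with tail-expansion p (<-wellFounded (suc ρ)) {D} (subst (ℕ._< D) remainder (n%ℕd<d N D))
...   | cs , ps , rep , par = mkExpansion (N /ℕ D) cs ps (represents-step rep division) par

fromℤ : ℤ → ℚ
fromℤ z = z ℚ./ 1

toℚᵘ-/ : ∀ z d .{{_ : NonZero d}} → toℚᵘ (z ℚ./ d) ≃ᵘ z ℚᵘ./ d
toℚᵘ-/ z (suc d) = ℚP.toℚᵘ-fromℚᵘ (mkℚᵘ z d)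

fromℤ-+ : ∀ a b → fromℤ (a + b) ≡ fromℤ a ℚ.+ fromℤ b
fromℤ-+ a b = ℚP.toℚᵘ-injective (begin
  toℚᵘ (fromℤ (a + b))                ≈⟨ toℚᵘ-/ (a + b) 1 ⟩
  mkℚᵘ (a + b) 0                      ≈⟨ *≡* (sum a b) ⟨
  mkℚᵘ a 0 ℚᵘ.+ mkℚᵘ b 0              ≈⟨ ℚᵘP.+-cong (toℚᵘ-/ a 1) (toℚᵘ-/ b 1) ⟨
  toℚᵘ (fromℤ a) ℚᵘ.+ toℚᵘ (fromℤ b)  ≈⟨ ℚP.toℚᵘ-homo-+ (fromℤ a) (fromℤ b) ⟨
  toℚᵘ (fromℤ a ℚ.+ fromℤ b)          ∎)
  where
  open ℚᵘP.≃-Reasoning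
  sum : ∀ a b → (a * + 1 + b * + 1) * + 1 ≡ (a + b) * + 1
  sum = solve-∀

fromℤ-* : ∀ a b → fromℤ (a * b) ≡ fromℤ a ℚ.* fromℤ b
fromℤ-* a b = ℚP.toℚᵘ-injective (begin
  toℚᵘ (fromℤ (a * b))                ≈⟨ toℚᵘ-/ (a * b) 1 ⟩
  mkℚᵘ (a * b) 0                      ≈⟨ ℚᵘP.*-cong (toℚᵘ-/ a 1) (toℚᵘ-/ b 1) ⟨
  toℚᵘ (fromℤ a) ℚᵘ.* toℚᵘ (fromℤ b)  ≈⟨ ℚP.toℚᵘ-homo-* (fromℤ a) (fromℤ b) ⟨
  toℚᵘ (fromℤ a ℚ.* fromℤ b)          ∎)
  where open ℚᵘP.≃-Reasoning

/-*-cancel : ∀ z d .{{_ : NonZero d}} → (z ℚ./ d) ℚ.* fromℤ (+ d) ≡ fromℤ z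
/-*-cancel z d@(suc d-1) = ℚP.toℚᵘ-injective (begin
  toℚᵘ ((z ℚ./ d) ℚ.* fromℤ (+ d))          ≈⟨ ℚP.toℚᵘ-homo-* (z ℚ./ d) (fromℤ (+ d)) ⟩
  toℚᵘ (z ℚ./ d) ℚᵘ.* toℚᵘ (fromℤ (+ d))   ≈⟨ ℚᵘP.*-cong (toℚᵘ-/ z d) (toℚᵘ-/ (+ d) 1) ⟩
  mkℚᵘ z d-1 ℚᵘ.* mkℚᵘ (+ d) 0             ≈⟨ *≡* cancel ⟩
  mkℚᵘ z 0                                  ≈⟨ toℚᵘ-/ z 1 ⟨
  toℚᵘ (fromℤ z)                            ∎)
  where
  open ℚᵘP.≃-Reasoning
  cancel : (z * + d) * + 1 ≡ z * + suc (ℕ.pred (d ℕ.* 1))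
  cancel rewrite ℕP.*-identityʳ d-1 = ℤP.*-identityʳ (z * + d)

affine-shift : ∀ c G j L L' D .{{_ : NonZero D}} → L ≡ L' + j * (+ D * G) →
  fromℤ (c + G * G * j) ≡ (fromℤ c ℚ.- (G ℚ./ D) ℚ.* fromℤ L') ℚ.+ (G ℚ./ D) ℚ.* fromℤ L
affine-shift c G j L L' D refl = sym (begin
  (fromℤ c ℚ.- β ℚ.* fromℤ L') ℚ.+ β ℚ.* fromℤ (L' + j * (+ D * G))
    ≡⟨ cong (λ x → (fromℤ c ℚ.- β ℚ.* fromℤ L') ℚ.+ β ℚ.* x) (trans (fromℤ-+ L' _)
         (cong (fromℤ L' ℚ.+_) (trans (fromℤ-* j _) (cong (fromℤ j ℚ.*_) (fromℤ-* (+ D) G))))) ⟩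
  (fromℤ c ℚ.- β ℚ.* fromℤ L') ℚ.+ β ℚ.* (fromℤ L' ℚ.+ fromℤ j ℚ.* (fromℤ (+ D) ℚ.* fromℤ G))
    ≡⟨ solve 6 (λ c L' β G D j → (c :- β :* L') :+ β :* (L' :+ j :* (D :* G)) := c :+ ((β :* D) :* G) :* j)
         refl (fromℤ c) (fromℤ L') β (fromℤ G) (fromℤ (+ D)) (fromℤ j) ⟩
  fromℤ c ℚ.+ ((β ℚ.* fromℤ (+ D)) ℚ.* fromℤ G) ℚ.* fromℤ j
    ≡⟨ cong (λ x → fromℤ c ℚ.+ (x ℚ.* fromℤ G) ℚ.* fromℤ j) (/-*-cancel G D) ⟩
  fromℤ c ℚ.+ (fromℤ G ℚ.* fromℤ G) ℚ.* fromℤ j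
    ≡⟨ trans (fromℤ-+ c (G * G * j)) (cong (fromℤ c ℚ.+_)
         (trans (fromℤ-* (G * G) j) (cong (ℚ._* fromℤ j) (fromℤ-* G G)))) ⟨
  fromℤ (c + G * G * j) ∎)
  where
  open ≡-Reasoning
  open +-*-Solver
  β : ℚ
  β = G ℚ./ D

δℤ : Sign → ℤ
δℤ Sign.+ = + 0
δℤ Sign.- = + 1

toℚᵘ-/-δ : ∀ z d .{{_ : NonZero d}} e → toℚᵘ ((z ℚ./ d) ℚ.- δ e) ≃ᵘ (z - δℤ e * + d) ℚᵘ./ d
toℚᵘ-/-δ z d@(suc d-1) e = begin
  toℚᵘ ((z ℚ./ d) ℚ.- δ e)             ≈⟨ ℚP.toℚᵘ-homo-+ (z ℚ./ d) (ℚ.- δ e) ⟩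
  toℚᵘ (z ℚ./ d) ℚᵘ.+ toℚᵘ (ℚ.- δ e)  ≈⟨ ℚᵘP.+-cong (toℚᵘ-/ z d) (toℚᵘ-neg-δ e) ⟩
  mkℚᵘ z d-1 ℚᵘ.+ mkℚᵘ (- δℤ e) 0     ≈⟨ *≡* sum ⟩
  mkℚᵘ (z - δℤ e * + d) d-1            ∎
  where
  open ℚᵘP.≃-Reasoning
  toℚᵘ-neg-δ : ∀ e → toℚᵘ (ℚ.- δ e) ≃ᵘ mkℚᵘ (- δℤ e) 0
  toℚᵘ-neg-δ Sign.+ = ℚᵘP.≃-refl
  toℚᵘ-neg-δ Sign.- = ℚᵘP.≃-refl
  collect : ∀ z δ d → (z * + 1 + (- δ) * d) * d ≡ (z - δ * d) * d
  collect = solve-∀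
  sum : (z * + 1 + (- δℤ e) * + d) * + d ≡ (z - δℤ e * + d) * + suc (ℕ.pred (d ℕ.* 1))
  sum rewrite ℕP.*-identityʳ d-1 = collect z (δℤ e) (+ d)

IsCFExpansion⇒Represents : ∀ {x N D c cs} .{{_ : NonZero D}} →
  toℚᵘ x ≃ᵘ N ℚᵘ./ D → IsCFExpansion x (c ∷ cs) → Represents N D (c ∷ cs)
IsCFExpansion⇒Represents {mkℚ n d-1 _} {N} {suc D-1} {c} {cs} (*≡* x≃N/D) (_ , value) =
  cross (ℤP.*-cancelʳ-≡ _ _ (+ suc d-1) (begin
    (N * q) * + suc d-1          ≡⟨ xy∙z≈xz∙y N q (+ suc d-1) ⟩
    (N * + suc d-1) * q          ≡⟨ cong (_* q) x≃N/D ⟨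
    (n * + suc D-1) * q          ≡⟨ xy∙z≈xz∙y n (+ suc D-1) q ⟩
    (n * q) * + suc D-1          ≡⟨ cong (_* + suc D-1) value ⟩
    (p * + suc d-1) * + suc D-1  ≡⟨ xy∙z≈xz∙y p (+ suc d-1) (+ suc D-1) ⟩
    (p * + suc D-1) * + suc d-1  ∎))
  where
  open ≡-Reasoning
  p q : ℤ
  p = proj₁ (cfND (c ∷ cs))
  q = proj₂ (cfND (c ∷ cs))

-- Congruences modulo s

infix 4 _≡_mod_

data _≡_mod_ (i j : ℤ) (n : ℕ) : Set where
  congruent : + n ℤS.∣ i - j → i ≡ j mod n

mod-refl : ∀ {n} i → i ≡ i mod n
mod-refl {n} i = congruent (divides (+ 0) (trans (ℤP.+-inverseʳ i) (sym (ℤP.*-zeroˡ (+ n)))))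

mod-sym : ∀ {n i j} → i ≡ j mod n → j ≡ i mod n
mod-sym {i = i} {j} (congruent n∣i-j) =
  congruent (subst (_ ℤS.∣_) (negate-minus i j) (ℤS.∣m⇒∣-m n∣i-j))
  where
  negate-minus : ∀ i j → - (i - j) ≡ j - i
  negate-minus = solve-∀

mod-+ : ∀ {n a a' b b'} → a ≡ a' mod n → b ≡ b' mod n → a + b ≡ a' + b' mod n
mod-+ {a = a} {a'} {b} {b'} (congruent n∣a-a') (congruent n∣b-b') =
  congruent (subst (_ ℤS.∣_) (regroup a a' b b') (ℤS.∣m∣n⇒∣m+n n∣a-a' n∣b-b'))
  where
  regroup : ∀ a a' b b' → (a - a') + (b - b') ≡ (a + b) - (a' + b')
  regroup = solve-∀

mod-* : ∀ {n a a' b b'} → a ≡ a' mod n → b ≡ b' mod n → a * b ≡ a' * b' mod n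
mod-* {a = a} {a'} {b} {b'} (congruent n∣a-a') (congruent n∣b-b') = congruent
  (subst (_ ℤS.∣_) (regroup a a' b b')
    (ℤS.∣m∣n⇒∣m+n (ℤS.∣n⇒∣m*n a n∣b-b') (ℤS.∣m⇒∣m*n b' n∣a-a')))
  where
  regroup : ∀ a a' b b' → a * (b - b') + (a - a') * b' ≡ a * b - a' * b'
  regroup = solve-∀

mod-∣ : ∀ {d n i j} → + d ℤS.∣ + n → i ≡ j mod n → i ≡ j mod d
mod-∣ d∣n (congruent n∣i-j) = congruent (ℤS.∣-trans d∣n n∣i-j)

mod-∣-transfer : ∀ {n i j} → i ≡ j mod n → + n ℤS.∣ i → + n ℤS.∣ j
mod-∣-transfer {i = i} {j} (congruent n∣i-j) n∣i =
  subst (_ ℤS.∣_) (cancel i j) (ℤS.∣m∣n⇒∣m-n n∣i n∣i-j)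
  where
  cancel : ∀ i j → i - (i - j) ≡ j
  cancel = solve-∀

mod-witness : ∀ {n i j} → i ≡ j mod n → Σ ℤ λ q → i ≡ j + q * + n
mod-witness {i = i} {j} (congruent (divides q i-j≡q*n)) = q , trans (split i j) (cong (_+_ j) i-j≡q*n)
  where
  split : ∀ i j → i ≡ j + (i - j)
  split = solve-∀

%-mod : ∀ {n} .{{_ : NonZero n}} a b → a % n ≡ b % n → + a ≡ + b mod n
%-mod {n} a b eq = congruent (divides (+ (a / n) - + (b / n)) (begin
  + a - + b
    ≡⟨ cong₂ _-_ (a≡a%ℕn+[a/ℕn]*n (+ a) n) (a≡a%ℕn+[a/ℕn]*n (+ b) n) ⟩
  (+ (a % n) + + (a / n) * + n) - (+ (b % n) + + (b / n) * + n)
    ≡⟨ cong (λ r → (+ (a % n) + + (a / n) * + n) - (+ r + + (b / n) * + n)) eq ⟨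
  (+ (a % n) + + (a / n) * + n) - (+ (a % n) + + (b / n) * + n)
    ≡⟨ cancel (+ (a % n)) (+ (a / n)) (+ (b / n)) (+ n) ⟩
  (+ (a / n) - + (b / n)) * + n ∎))
  where
  open ≡-Reasoning
  cancel : ∀ r x y n → (r + x * n) - (r + y * n) ≡ (x - y) * n
  cancel = solve-∀

gcd-∣-mod : ∀ {s a a'} → a ≡ a' mod s → (gcd ∣ a ∣ s) ℕD.∣ (gcd ∣ a' ∣ s)
gcd-∣-mod {s} {a} {a'} a≡a' = gcd-greatest (ℤS.∣⇒∣ᵤ g∣a') (gcd[m,n]∣n ∣ a ∣ s)
  where
  g∣a' : + (gcd ∣ a ∣ s) ℤS.∣ a'
  g∣a' = mod-∣-transfer (mod-∣ (ℤS.∣ᵤ⇒∣ (gcd[m,n]∣n ∣ a ∣ s)) a≡a')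
    (ℤS.∣ᵤ⇒∣ (gcd[m,n]∣m ∣ a ∣ s))

gcd-mod : ∀ {s a a'} → a ≡ a' mod s → (gcd ∣ a ∣ s) ≡ (gcd ∣ a' ∣ s)
gcd-mod a≡a' = ℕD.∣-antisym (gcd-∣-mod a≡a') (gcd-∣-mod (mod-sym a≡a'))

%ℕ-≡0 : ∀ a g .{{_ : NonZero g}} → g ℕD.∣ ∣ a ∣ → a %ℕ g ≡ 0
%ℕ-≡0 (+ n) g g∣a = ℕD.n∣m⇒m%n≡0 n g g∣a
%ℕ-≡0 -[1+ n ] g g∣a with suc n % g in r
... | zero = refl
... | suc _ = ⊥-elim (ℕP.0≢1+n (trans (sym (ℕD.n∣m⇒m%n≡0 (suc n) g g∣a)) r))

/ℕ-exact : ∀ a g .{{_ : NonZero g}} → g ℕD.∣ ∣ a ∣ → (a /ℕ g) * + g ≡ a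
/ℕ-exact a g g∣a = sym (trans (a≡a%ℕn+[a/ℕn]*n a g)
  (trans (cong (λ r → + r + (a /ℕ g) * + g) (%ℕ-≡0 a g g∣a)) (ℤP.+-identityˡ _)))

∣/ℕ∣ : ∀ a g .{{_ : NonZero g}} → g ℕD.∣ ∣ a ∣ → ∣ a /ℕ g ∣ ≡ ∣ a ∣ / g
∣/ℕ∣ a g g∣a = sym (trans (cong (_/ g) (sym (trans (sym (ℤP.abs-* (a /ℕ g) (+ g)))
  (cong ∣_∣ (/ℕ-exact a g g∣a))))) (ℕDM.m*n/n≡m ∣ a /ℕ g ∣ g))

/ℕ-congʳ : ∀ a {g h} .{{_ : NonZero g}} .{{_ : NonZero h}} → g ≡ h → a /ℕ g ≡ a /ℕ h
/ℕ-congʳ a refl = refl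

/ℕ-mod : ∀ {d g a a'} .{{_ : NonZero g}} → a ≡ a' mod (d ℕ.* g) →
  g ℕD.∣ ∣ a ∣ → g ℕD.∣ ∣ a' ∣ → a /ℕ g ≡ a' /ℕ g mod d
/ℕ-mod {d} {g} {a} {a'} (congruent (divides q a-a'≡q*dg)) g∣a g∣a' =
  congruent (divides q (ℤP.*-cancelʳ-≡ _ _ (+ g) (begin
    (a /ℕ g - a' /ℕ g) * + g          ≡⟨ distrib (a /ℕ g) (a' /ℕ g) (+ g) ⟩
    (a /ℕ g) * + g - (a' /ℕ g) * + g  ≡⟨ cong₂ _-_ (/ℕ-exact a g g∣a) (/ℕ-exact a' g g∣a') ⟩
    a - a'                            ≡⟨ a-a'≡q*dg ⟩
    q * + (d ℕ.* g)                   ≡⟨ cong (q *_) (ℤP.pos-* d g) ⟩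
    q * (+ d * + g)                   ≡⟨ ℤP.*-assoc q (+ d) (+ g) ⟨
    q * + d * + g                     ∎)))
  where
  open ≡-Reasoning
  distrib : ∀ x y z → (x - y) * z ≡ x * z - y * z
  distrib = solve-∀

-- Dependence of the sequences on the residues of v and m

vₙ-linVar : ∀ v m n → vₙ v n ℕ.* m ≡ linVar n v m
vₙ-linVar v m zero = refl
vₙ-linVar v m (suc zero) = ℕP.*-identityˡ m
vₙ-linVar v m (suc (suc n)) = vₙ-linVar v m n

module _ (s : ℕ) .{{_ : NonZero s}} (e : Sign) (v m n : ℕ) where

  sₙ∣s : sₙ s e v m n ℕD.∣ s
  sₙ∣s = gcd[m,n]∣n ∣ aₙ e v m n ∣ s

  dₙ*sₙ≡s : dₙ s e v m n ℕ.* sₙ s e v m n ≡ s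
  dₙ*sₙ≡s = ℕDM.m/n*n≡m {{sₙ-nonZero s e v m n}} sₙ∣s

  dₙ∣s : dₙ s e v m n ℕD.∣ s
  dₙ∣s = ℕD.m/n∣m {{sₙ-nonZero s e v m n}} sₙ∣s

module _ {s : ℕ} .{{_ : NonZero s}} {v v' m m' : ℕ} (v≡v' : v % s ≡ v' % s) (m≡m' : m % s ≡ m' % s) where

  vₙ-mod : ∀ n → + vₙ v n ≡ + vₙ v' n mod s
  vₙ-mod zero = %-mod v v' v≡v'
  vₙ-mod (suc zero) = mod-refl (+ 1)
  vₙ-mod (suc (suc n)) = vₙ-mod n

  vₙ*m-mod : ∀ n → + (vₙ v n ℕ.* m) ≡ + (vₙ v' n ℕ.* m') mod s
  vₙ*m-mod n = subst₂ (λ x y → x ≡ y mod s) (sym (ℤP.pos-* (vₙ v n) m)) (sym (ℤP.pos-* (vₙ v' n) m'))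
    (mod-* (vₙ-mod n) (%-mod m m' m≡m'))

  linVar-mod : ∀ n → + linVar n v m ≡ + linVar n v' m' mod s
  linVar-mod n = subst₂ (λ x y → + x ≡ + y mod s) (vₙ-linVar v m n) (vₙ-linVar v' m' n) (vₙ*m-mod n)

  aₙ-mod : ∀ e n → aₙ e v m n ≡ aₙ e v' m' n mod s
  aₙ-mod e zero = mod-refl (+ 0)
  aₙ-mod e (suc zero) = mod-refl (+ 1)
  aₙ-mod e (suc (suc n)) =
    mod-+ (mod-* (vₙ*m-mod (suc n)) (aₙ-mod e (suc n))) (mod-* (mod-refl (εℤ e)) (aₙ-mod e n))

  sₙ-cong : ∀ e n → sₙ s e v m n ≡ sₙ s e v' m' n
  sₙ-cong e n = gcd-mod (aₙ-mod e n)

  dₙ-cong : ∀ e n → dₙ s e v m n ≡ dₙ s e v' m' n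
  dₙ-cong e n = ℕDM./-congʳ {{sₙ-nonZero s e v m n}} {{sₙ-nonZero s e v' m' n}} (sₙ-cong e n)

  aₙ/sₙ-mod : ∀ e n → aₙ/sₙ s e v m n ≡ aₙ/sₙ s e v' m' n mod dₙ s e v' m' n
  aₙ/sₙ-mod e n = subst (λ x → x ≡ aₙ/sₙ s e v' m' n mod dₙ s e v' m' n)
    (/ℕ-congʳ (aₙ e v m n) {{sₙ-nonZero s e v' m' n}} {{sₙ-nonZero s e v m n}} (sym (sₙ-cong e n)))
    (/ℕ-mod {{sₙ-nonZero s e v' m' n}}
      (subst (λ t → aₙ e v m n ≡ aₙ e v' m' n mod t) (sym (dₙ*sₙ≡s s e v' m' n)) (aₙ-mod e n))
      (subst (ℕD._∣ ∣ aₙ e v m n ∣) (sₙ-cong e n) (gcd[m,n]∣m ∣ aₙ e v m n ∣ s))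
      (gcd[m,n]∣m ∣ aₙ e v' m' n ∣ s))

  IsMₙ-cong : ∀ e n {k} → IsMₙ s e v m n k → IsMₙ s e v' m' n k
  IsMₙ-cong e n {k} (0≤k , k<d , d∣ku+b) =
    0≤k , subst (λ d → k ℤ.< + d) (dₙ-cong e n) k<d , ℤS.∣⇒∣ᵤ (mod-∣-transfer ku+b≡ku'+b'
      (ℤS.∣ᵤ⇒∣ (subst (λ d → + d ℤD.∣ (k * aₙ/sₙ s e v m n + aₙ e v m (n ℕ.∸ 1)))
                      (dₙ-cong e n) d∣ku+b)))
    where
    ku+b≡ku'+b' : k * aₙ/sₙ s e v m n + aₙ e v m (n ℕ.∸ 1)
                  ≡ k * aₙ/sₙ s e v' m' n + aₙ e v' m' (n ℕ.∸ 1) mod dₙ s e v' m' n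
    ku+b≡ku'+b' = mod-+ (mod-* (mod-refl k) (aₙ/sₙ-mod e n))
                        (mod-∣ (ℤS.∣ᵤ⇒∣ (dₙ∣s s e v' m' n)) (aₙ-mod e (n ℕ.∸ 1)))

-- The residue m_n

∣-<⇒≡0 : ∀ {d x} → d ℕD.∣ x → x ℕ.< d → x ≡ 0
∣-<⇒≡0 {x = zero} _ _ = refl
∣-<⇒≡0 {x = suc x} d∣x x<d = ⊥-elim (ℕD.>⇒∤ x<d d∣x)

module _ (s : ℕ) .{{_ : NonZero s}} (e : Sign) (v m n : ℕ) where

  private
    instance
      sₙ≢0 : NonZero (sₙ s e v m n)
      sₙ≢0 = sₙ-nonZero s e v m n
    a b u : ℤ
    a = aₙ e v m n
    b = aₙ e v m (n ℕ.∸ 1)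
    u = aₙ/sₙ s e v m n
    d : ℕ
    d = dₙ s e v m n

  dₙ-coprime : Coprime (+ d) u
  dₙ-coprime = subst (ℕC.Coprime d) (sym (∣/ℕ∣ a (sₙ s e v m n) (gcd[m,n]∣m ∣ a ∣ s)))
    (ℕC.sym (ℕC.coprime-/gcd ∣ a ∣ s))

  IsMₙ-unique : ∀ {k k'} → IsMₙ s e v m n k → IsMₙ s e v m n k' → k ≡ k'
  IsMₙ-unique {+ i} {+ j} (_ , +<+ i<d , d∣iu+b) (_ , +<+ j<d , d∣ju+b) =
    ℤP.i-j≡0⇒i≡j (+ i) (+ j) (ℤP.∣i∣≡0⇒i≡0 (∣-<⇒≡0 d∣i-j ∣i-j∣<d))
    where
    difference : ∀ x y u b → (x * u + b) - (y * u + b) ≡ u * (x - y)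
    difference = solve-∀
    d∣u[i-j] : + d ℤD.∣ u * (+ i - + j)
    d∣u[i-j] = ℤS.∣⇒∣ᵤ (subst (+ d ℤS.∣_) (difference (+ i) (+ j) u b)
      (ℤS.∣m∣n⇒∣m-n {+ d} {+ i * u + b} {+ j * u + b} (ℤS.∣ᵤ⇒∣ d∣iu+b) (ℤS.∣ᵤ⇒∣ d∣ju+b)))
    d∣i-j : d ℕD.∣ ∣ + i - + j ∣
    d∣i-j = coprime-divisor (+ d) u (+ i - + j) dₙ-coprime d∣u[i-j]
    ∣i-j∣<d : ∣ + i - + j ∣ ℕ.< d
    ∣i-j∣<d = ℕP.≤-<-trans
      (subst (ℕ._≤ i ℕ.⊔ j) (cong ∣_∣ (sym (ℤP.m-n≡m⊖n i j))) (ℤP.∣m⊝n∣≤m⊔n i j))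
      (ℕP.⊔-lub i<d j<d)

  IsMₙ? : Dec (Σ ℤ (IsMₙ s e v m n))
  IsMₙ? = map′ (λ (i , d∣iu+b) → + toℕ i , +≤+ z≤n , +<+ (toℕ<n i) , d∣iu+b)
    (λ { (+ i , _ , +<+ i<d , d∣iu+b) →
         fromℕ< i<d , subst (λ x → + d ℤD.∣ (+ x * u + b)) (sym (toℕ-fromℕ< i<d)) d∣iu+b })
    (any? (λ i → d ℕD.∣? ∣ + toℕ i * u + b ∣))

-- The packets

tailParity : Sign → Parity
tailParity Sign.+ = 0ℙ
tailParity Sign.- = 1ℙ

goodParity⇒tailParity : ∀ e n → GoodParity e (suc n) → ℕ.parity n ≡ tailParity e
goodParity⇒tailParity Sign.+ zero _ = refl
goodParity⇒tailParity Sign.+ (suc zero) ()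
goodParity⇒tailParity Sign.+ (suc (suc n)) h = goodParity⇒tailParity Sign.+ n h
goodParity⇒tailParity Sign.- zero ()
goodParity⇒tailParity Sign.- (suc zero) _ = refl
goodParity⇒tailParity Sign.- (suc (suc n)) h = goodParity⇒tailParity Sign.- n h

-- The numerator of target over d = s/s_n, with s_n v_n m written as g L for L = linVar n v m.
numerator : Sign → ℕ → (g L : ℕ) → ℤ → (d : ℕ) → ℤ
numerator e zero g L k d = + g * + L - εℤ e * k
numerator e (suc n) g L k d = + g * + L - εℤ e * k - δℤ e * + d

numerator-shift : ∀ e n g L L' k d j → + L ≡ + L' + j * (+ d * + g) →
  numerator e n g L k d ≡ numerator e n g L' k d + (+ g * + g * j) * + d
numerator-shift e zero g L L' k d j eq =
  trans (cong (λ y → + g * y - εℤ e * k) eq) (shift (+ g) (+ L') j (+ d) (εℤ e * k))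
  where
  shift : ∀ g L j d x → g * (L + j * (d * g)) - x ≡ (g * L - x) + (g * g * j) * d
  shift = solve-∀
numerator-shift e (suc n) g L L' k d j eq =
  trans (cong (λ y → + g * y - εℤ e * k - δℤ e * + d) eq) (shift (+ g) (+ L') j (+ d) (εℤ e * k) (δℤ e))
  where
  shift : ∀ g L j d x δ → g * (L + j * (d * g)) - x - δ * d ≡ (g * L - x - δ * d) + (g * g * j) * d
  shift = solve-∀

ξ̂-numerator : ∀ s .{{_ : NonZero s}} e v m n → ℤ → ℤ
ξ̂-numerator s e v m n k = + (sₙ s e v m n ℕ.* vₙ v n ℕ.* m) - εℤ e * k

ξ̂-numerator≡ : ∀ s .{{_ : NonZero s}} e v m n k →
  ξ̂-numerator s e v m n k ≡ + sₙ s e v m n * + linVar n v m - εℤ e * k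
ξ̂-numerator≡ s e v m n k = cong (_- εℤ e * k) (trans
  (cong +_ (trans (ℕP.*-assoc (sₙ s e v m n) (vₙ v n) m) (cong (sₙ s e v m n ℕ.*_) (vₙ-linVar v m n))))
  (ℤP.pos-* (sₙ s e v m n) (linVar n v m)))

target-≃ : ∀ s .{{_ : NonZero s}} e v m n k → toℚᵘ (target s e v m n k) ≃ᵘ
  (numerator e n (sₙ s e v m n) (linVar n v m) k (dₙ s e v m n) ℚᵘ./ dₙ s e v m n) {{dₙ-nonZero s e v m n}}
target-≃ s e v m zero k =
  ℚᵘP.≃-trans (toℚᵘ-/ (ξ̂-numerator s e v m zero k) _ {{dₙ-nonZero s e v m zero}})
  (ℚᵘP.≃-reflexive (cong (λ z → (z ℚᵘ./ dₙ s e v m zero) {{dₙ-nonZero s e v m zero}})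
    (ξ̂-numerator≡ s e v m zero k)))
target-≃ s e v m (suc n) k =
  ℚᵘP.≃-trans (toℚᵘ-/-δ (ξ̂-numerator s e v m (suc n) k) _ {{dₙ-nonZero s e v m (suc n)}} e)
  (ℚᵘP.≃-reflexive (cong (λ z → ((z - δℤ e * + dₙ s e v m (suc n)) ℚᵘ./ dₙ s e v m (suc n))
    {{dₙ-nonZero s e v m (suc n)}}) (ξ̂-numerator≡ s e v m (suc n) k)))

module Reference (s : ℕ) .{{_ : NonZero s}} (e : Sign) (rv rm n : ℕ) {k* : ℤ}
                 (isM* : IsMₙ s e rv rm n k*) where

  g d L* : ℕ
  g = sₙ s e rv rm n
  d = dₙ s e rv rm n
  L* = linVar n rv rm

  instance
    d≢0 : NonZero d
    d≢0 = dₙ-nonZero s e rv rm n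

  reference : Expansion (numerator e n g L* k* d) d (tailParity e)
  reference = expansion (tailParity e) (numerator e n g L* k* d) d

  open Expansion reference public

  β α : ℚ
  β = + g ℚ./ d
  α = fromℤ head ℚ.- β ℚ.* fromℤ (+ L*)

  packet-shape : ∀ {v m} → v % s ≡ rv % s → m % s ≡ rm % s → ∀ E → IsPacket s e v m n E →
    Σ ℤ λ c₀ → E ≡ c₀ ∷ tail × fromℤ c₀ ≡ α ℚ.+ β ℚ.* fromℤ (+ linVar n v m)
  packet-shape {v} {m} v≡rv m≡rm (c₀ ∷ cs) (k , isM , cf@(ps , _) , parity) =
    c₀ , cong (c₀ ∷_) (proj₂ shifted) ,
    trans (cong fromℤ (proj₁ shifted)) (affine-shift head (+ g) j (+ L) (+ L*) d L≡)
    where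
    L : ℕ
    L = linVar n v m
    j : ℤ
    j = proj₁ (mod-witness (linVar-mod v≡rv m≡rm n))
    L≡ : + L ≡ + L* + j * (+ d * + g)
    L≡ = trans (proj₂ (mod-witness (linVar-mod v≡rv m≡rm n)))
      (cong (λ x → + L* + j * x) (trans (cong +_ (sym (dₙ*sₙ≡s s e rv rm n))) (ℤP.pos-* d g)))
    k≡k* : k ≡ k*
    k≡k* = IsMₙ-unique s e rv rm n (IsMₙ-cong v≡rv m≡rm e n isM) isM*
    numerator≡ : numerator e n (sₙ s e v m n) L k (dₙ s e v m n)
                 ≡ numerator e n g L* k* d + (+ g * + g * j) * + d
    numerator≡ = trans (cong₂ (λ x y → numerator e n x L y (dₙ s e v m n)) (sₙ-cong v≡rv m≡rm e n) k≡k*)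
      (trans (cong (numerator e n g L k*) (dₙ-cong v≡rv m≡rm e n)) (numerator-shift e n g L L* k* d j L≡))
    E-represents : Represents (numerator e n g L* k* d + (+ g * + g * j) * + d) d (c₀ ∷ cs)
    E-represents = subst₂ (λ N D → Represents N D (c₀ ∷ cs)) numerator≡ (dₙ-cong v≡rv m≡rm e n)
      (IsCFExpansion⇒Represents {{dₙ-nonZero s e v m n}} (target-≃ s e v m n k) cf)
    shifted : c₀ ≡ head + + g * + g * j × cs ≡ tail
    shifted = ∷-injective (expansions-unique ps tail-positive
      (trans (goodParity⇒tailParity e (length cs) parity) (sym tail-parity))
      E-represents (represents-shift (+ g * + g * j) represents))

theorem5p1 : (s : ℕ) .{{_ : NonZero s}} (e : Sign) (rv rm : ℕ) (n : ℕ) →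
    Σ (List ℤ) λ tail → Σ ℚ λ α → Σ ℚ λ β →
      (v m : ℕ) → 1 ℕ.≤ v → 1 ℕ.≤ m → v % s ≡ rv % s → m % s ≡ rm % s →
      (e ≡ Sign.- → 4 ℕ.< v ℕ.* m ℕ.* m) →
      (E : List ℤ) → IsPacket s e v m n E →
      Σ ℤ λ c₀ → (E ≡ c₀ ∷ tail)
        × (c₀ ℚ./ 1 ≡ α ℚ.+ β ℚ.* (+ linVar n v m ℚ./ 1))
theorem5p1 s e rv rm n with IsMₙ? s e rv rm n
... | no ∄m₀ = [] , 0ℚ , 0ℚ , λ v m _ _ v≡rv m≡rm _ E (k , isM , _) →
  ⊥-elim (∄m₀ (k , IsMₙ-cong v≡rv m≡rm e n isM))
... | yes (k* , isM*) = tail , α , β , λ v m _ _ v≡rv m≡rm _ → packet-shape v≡rv m≡rm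
  where open Reference s e rv rm n isM*
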